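{- Let $G=G(k,m,P)$ be a random intersection graph and let $X_1,\dots,X_k$ be the sizes of the random sets $S_1,\dots,S_k$ defining $G$. For any integers $x_1,\dots,x_k$ such that the event $B=\{X_1=x_1,\dots,X_k=x_k\}$ has positive probability, \[\mathbb P(G\text{ has a rainbow }\mathcal K_k\mid B)\le m^{ -k(k-1)/2}(x_1x_2\cdots x_k)^{k-1}.\]
   Context: Random intersection graph $G(k,m,P)$: for a probability measure $P$ on $\{0,\dots,m\}$, vertex set $\{1,\dots,k\}$, attribute set $W$ with $|W|=m$; independent random subsets $S_1,\dots,S_k$ of $W$ with $\mathbb P(S_v=S)=P(|S|)/\binom m{|S|}$; $u\sim v$ iff $S_u\cap S_v\ne\emptyset$. $G$ has a rainbow $\mathcal K_k$ if each pair $\{u,v\}$ of its $k$ vertices can be assigned an attribute in $S_u\cap S_v$ so that all $\binom k2$ assigned attributes are distinct.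
   Formalization: The probability measure P on {0,…,m} assigns rational masses to the points. -}

module Defs where

open import Data.Nat as ℕ using (ℕ; zero; suc)
open import Data.Nat.Combinatorics using (_C_)
open import Data.Fin as Fin using (Fin)
open import Data.Fin.Subset using (Subset; ∣_∣; _∈_; inside; outside)
open import Data.Vec using (Vec; []; _∷_; lookup)
open import Data.List using (List; []; _∷_; map; _++_; concatMap)
open import Data.Rational as ℚ using (ℚ; 0ℚ; 1ℚ; _+_; _*_; _<_)
open import Data.Integer using (+_)
open import Data.Product using (Σ; _×_; _,_)
open import Relation.Binary.PropositionalEquality using (_≡_)
open import Relation.Nullary using (Dec; yes; no)
open import Relation.Unary using (Pred; Decidable)
import Agda.Primitive

allSubsets : (n : ℕ) → List (Subset n)
allSubsets zero = [] ∷ []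
allSubsets (suc n) = map (inside ∷_) (allSubsets n) ++ map (outside ∷_) (allSubsets n)

allTuples : (m k : ℕ) → List (Vec (Subset m) k)
allTuples m zero = [] ∷ []
allTuples m (suc k) = concatMap (λ S → map (S ∷_) (allTuples m k)) (allSubsets m)

sumUpTo : ℕ → (ℕ → ℚ) → ℚ
sumUpTo zero f = f 0
sumUpTo (suc n) f = sumUpTo n f + f (suc n)

IsProbOn : ℕ → (ℕ → ℚ) → Set
IsProbOn m P = (∀ j → 0ℚ ℚ.≤ P j) × (∀ j → m ℕ.< j → P j ≡ 0ℚ) × (sumUpTo m P ≡ 1ℚ)

-- 1/n as a rational (only used with n = binomial m j ≥ 1, j ≤ m).
inv : ℕ → ℚ
inv zero = 0ℚ
inv (suc n) = (+ 1) ℚ./ suc n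

-- P(S_v = S) = P(|S|) / C(m,|S|)
setWeight : (m : ℕ) → (ℕ → ℚ) → Subset m → ℚ
setWeight m P S = P ∣ S ∣ * inv (m C ∣ S ∣)

tupleWeight : (m : ℕ) → (ℕ → ℚ) → {k : ℕ} → Vec (Subset m) k → ℚ
tupleWeight m P [] = 1ℚ
tupleWeight m P (S ∷ Ss) = setWeight m P S * tupleWeight m P Ss

sumList : {A : Set} → (A → ℚ) → List A → ℚ
sumList f [] = 0ℚ
sumList f (a ∷ as) = f a + sumList f as

indicator : {A : Set} → Dec A → ℚ → ℚ
indicator (yes _) q = q
indicator (no _) q = 0ℚ

Pr : (k m : ℕ) (P : ℕ → ℚ) {A : Pred (Vec (Subset m) k) Agda.Primitive.lzero} → Decidable A → ℚ
Pr k m P dec = sumList (λ S → indicator (dec S) (tupleWeight m P S)) (allTuples m k)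

Rainbow : {k m : ℕ} → Vec (Subset m) k → Set
Rainbow {k} {m} S =
  Σ (Fin k → Fin k → Fin m) λ f →
    (∀ u v → u Fin.< v → (f u v ∈ lookup S u) × (f u v ∈ lookup S v)) ×
    (∀ u v u' v' → u Fin.< v → u' Fin.< v' → f u v ≡ f u' v' → (u ≡ u') × (v ≡ v'))

SizesAre : {k m : ℕ} → (Fin k → ℕ) → Vec (Subset m) k → Set
SizesAre {k} x S = ∀ v → ∣ lookup S v ∣ ≡ x v

∩-dec : {X : Set} {A B : Pred X Agda.Primitive.lzero} → Decidable A → Decidable B → Decidable (λ s → A s × B s)
∩-dec dA dB s with dA s | dB s
... | yes a | yes b = yes (a , b)
... | no na | _ = no (λ p → na (Data.Product.proj₁ p))
  where import Data.Product
... | yes _ | no nb = no (λ p → nb (Data.Product.proj₂ p))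
  where import Data.Product

condPr : (k m : ℕ) (P : ℕ → ℚ) {A B : Pred (Vec (Subset m) k) Agda.Primitive.lzero}
         → Decidable A → (dB : Decidable B) → 0ℚ < Pr k m P dB → ℚ
condPr k m P dA dB pos =
  Pr k m P (∩-dec dA dB) * (ℚ.1/ Pr k m P dB) {{ℚ.>-nonZero pos}}

prodℕ : {k : ℕ} → (Fin k → ℕ) → ℕ
prodℕ {zero} x = 1
prodℕ {suc k} x = x Fin.zero ℕ.* prodℕ (λ i → x (Fin.suc i))

module Submission where

-- Every outcome in B = {X = x} has the same probability, so the conditional probability is
-- #(rainbow ∩ B) / #B, a ratio of numbers of tuples of sets.
-- A rainbow K_k yields an injective assignment c of attributes to the k(k-1)/2 pairs, and
-- then each S_v must contain the k - 1 distinct attributes c puts on the pairs at v.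
-- Among the C(m, x) sets of size x, those containing a fixed a-set number
-- C(m - a, x - a) ≤ (x / m)^a C(m, x).  A union bound over the m^(k(k-1)/2) assignments gives
--   #(rainbow ∩ B) ≤ m^(k(k-1)/2) ∏_v (x_v / m)^(k-1) C(m, x_v) = m^(-k(k-1)/2) (∏_v x_v)^(k-1) #B.

open import Defs
open import Agda.Primitive using (lzero)
open import Data.Empty using (⊥-elim)
open import Data.Fin as F using (Fin)
open import Data.Fin.Properties using (all?) renaming (suc-injective to Fin-suc-injective)
open import Data.Fin.Subset using (Side; Subset; inside; outside; ∣_∣; _∈_; _∉_; _⊆_; _∪_; ⁅_⁆; ⊥)
open import Data.Fin.Subset.Properties
  using ( _⊆?_; drop-∷-⊆; out⊆; in⊆in; ⊆-min; ∣p∣≤n; ∣⊥∣≡0; p⊆q⇒∣p∣≤∣q∣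
        ; x∈p∪q⁻; x∈⁅y⁆⇒x≡y; ∪-identityʳ; ∉⊥)
open import Data.List using (List; []; _∷_; [_]; _++_; map; concatMap; cartesianProductWith; length; allFin)
open import Data.List.Membership.Propositional using () renaming (_∈_ to _∈ₗ_)
open import Data.List.Membership.Propositional.Properties using (∈-cartesianProductWith⁺; ∈-allFin)
open import Data.List.Properties using (length-++; length-map; length-tabulate)
open import Data.List.Relation.Unary.Any using (here; there)
open import Data.Nat.Combinatorics using (_C_; k>n⇒nCk≡0; nC1≡n; nCk+nC[k+1]≡[n+1]C[k+1])
open import Data.Product using (_×_; _,_; proj₁; proj₂; ∃-syntax)
open import Data.Sum using (inj₁; inj₂)
open import Data.Unit using (⊤; tt)
open import Data.Vec using (Vec; []; _∷_; lookup; replicate; tabulate; zipWith; here; there)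
open import Data.Vec.Properties using (lookup-replicate; lookup∘tabulate; lookup-zipWith)
open import Function using (_∘_; _⇔_; mk⇔; Equivalence; case_of_)
open import Relation.Binary.PropositionalEquality
  using (_≡_; _≢_; refl; sym; trans; cong; cong₂; subst; subst₂; module ≡-Reasoning)
open import Relation.Nullary using (Dec; yes; no; ¬_)
open import Relation.Nullary.Decidable using (_×-dec_)
open import Relation.Unary using (Pred; Decidable)

module Counting where

  open import Data.Nat
    using (ℕ; zero; suc; NonZero; _+_; _*_; _∸_; _^_; _≤_; _<_; z≤n; s≤s; z<s; s<s; _≟_; _≤?_; _<?_)
  open import Data.Nat.DivMod using (_/_; m*n/n≡m)
  open import Data.Nat.Properties
  open import Data.Nat.Solver using (module +-*-Solver)
  import Algebra.Properties.CommutativeSemigroup as CommutativeSemigroupProperties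

  open +-*-Solver
  open CommutativeSemigroupProperties +-commutativeSemigroup using () renaming (interchange to +-interchange)

  private
    variable
      X Y Z : Set
      k m n : ℕ

  𝟙 : {P : Set} → Dec P → ℕ
  𝟙 (yes _) = 1
  𝟙 (no _) = 0

  𝟙-yes : {P : Set} (P? : Dec P) → P → 𝟙 P? ≡ 1
  𝟙-yes (yes _) _ = refl
  𝟙-yes (no ¬p) p = ⊥-elim (¬p p)

  count : {P : Pred X lzero} → Decidable P → List X → ℕ
  count P? [] = 0
  count P? (a ∷ as) = 𝟙 (P? a) + count P? as

  ∑ : List X → (X → ℕ) → ℕ
  ∑ [] f = 0
  ∑ (a ∷ as) f = f a + ∑ as f

  module _ {P Q : Pred X lzero} (P? : Decidable P) (Q? : Decidable Q) where

    count-cong : (∀ a → P a → Q a) → (∀ a → Q a → P a) → ∀ as → count P? as ≡ count Q? as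
    count-cong P⇒Q Q⇒P [] = refl
    count-cong P⇒Q Q⇒P (a ∷ as) = cong₂ _+_ (𝟙-cong (P? a) (Q? a)) (count-cong P⇒Q Q⇒P as)
      where
        𝟙-cong : (p : Dec (P a)) (q : Dec (Q a)) → 𝟙 p ≡ 𝟙 q
        𝟙-cong (yes _) (yes _) = refl
        𝟙-cong (yes p) (no ¬q) = ⊥-elim (¬q (P⇒Q a p))
        𝟙-cong (no ¬p) (yes q) = ⊥-elim (¬p (Q⇒P a q))
        𝟙-cong (no _) (no _) = refl

  module _ {P : Pred X lzero} (P? : Decidable P) where

    count-none : (∀ a → ¬ P a) → ∀ as → count P? as ≡ 0
    count-none ¬P [] = refl
    count-none ¬P (a ∷ as) with P? a
    ... | yes p = ⊥-elim (¬P a p)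
    ... | no _ = count-none ¬P as

    count-++ : ∀ as bs → count P? (as ++ bs) ≡ count P? as + count P? bs
    count-++ [] bs = refl
    count-++ (a ∷ as) bs = trans (cong (𝟙 (P? a) +_) (count-++ as bs)) (sym (+-assoc (𝟙 (P? a)) _ _))

    count-map : (f : Y → X) → ∀ bs → count P? (map f bs) ≡ count (P? ∘ f) bs
    count-map f [] = refl
    count-map f (b ∷ bs) = cong (𝟙 (P? (f b)) +_) (count-map f bs)

  concatMap-map≡cartesianProductWith : (f : X → Y → Z) (as : List X) (bs : List Y) →
    concatMap (λ a → map (f a) bs) as ≡ cartesianProductWith f as bs
  concatMap-map≡cartesianProductWith f [] bs = refl
  concatMap-map≡cartesianProductWith f (a ∷ as) bs =
    cong (map (f a) bs ++_) (concatMap-map≡cartesianProductWith f as bs)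

  length-cartesianProductWith : (f : X → Y → Z) (as : List X) (bs : List Y) →
    length (cartesianProductWith f as bs) ≡ length as * length bs
  length-cartesianProductWith f [] bs = refl
  length-cartesianProductWith f (a ∷ as) bs = begin
    length (map (f a) bs ++ cartesianProductWith f as bs)           ≡⟨ length-++ (map (f a) bs) ⟩
    length (map (f a) bs) + length (cartesianProductWith f as bs)
      ≡⟨ cong₂ _+_ (length-map (f a) bs) (length-cartesianProductWith f as bs) ⟩
    length bs + length as * length bs                               ∎
    where open ≡-Reasoning

  count-cartesianProductWith :
    {P : Pred Z lzero} (P? : Decidable P) {P₁ : Pred X lzero} (P₁? : Decidable P₁)
    {P₂ : Pred Y lzero} (P₂? : Decidable P₂) (f : X → Y → Z) → (∀ a b → P (f a b) ⇔ (P₁ a × P₂ b)) →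
    ∀ as bs → count P? (cartesianProductWith f as bs) ≡ count P₁? as * count P₂? bs
  count-cartesianProductWith P? P₁? P₂? f P⇔ [] bs = refl
  count-cartesianProductWith P? P₁? P₂? f P⇔ (a ∷ as) bs = begin
    count P? (map (f a) bs ++ cartesianProductWith f as bs)
      ≡⟨ count-++ P? (map (f a) bs) _ ⟩
    count P? (map (f a) bs) + count P? (cartesianProductWith f as bs)
      ≡⟨ cong₂ _+_ (trans (count-map P? (f a) bs) (row (P₁? a)))
                   (count-cartesianProductWith P? P₁? P₂? f P⇔ as bs) ⟩
    𝟙 (P₁? a) * count P₂? bs + count P₁? as * count P₂? bs
      ≡⟨ *-distribʳ-+ (count P₂? bs) (𝟙 (P₁? a)) (count P₁? as) ⟨
    count P₁? (a ∷ as) * count P₂? bs ∎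
    where
      open ≡-Reasoning
      open Equivalence
      row : (d : Dec _) → count (P? ∘ f a) bs ≡ 𝟙 d * count P₂? bs
      row (yes p₁) =
        trans (count-cong _ P₂? (λ b → proj₂ ∘ to (P⇔ a b)) (λ b p₂ → from (P⇔ a b) (p₁ , p₂)) bs)
              (sym (+-identityʳ _))
      row (no ¬p₁) = count-none _ (λ b → ¬p₁ ∘ proj₁ ∘ to (P⇔ a b)) bs

  ∑-+ : (as : List X) (f g : X → ℕ) → ∑ as (λ a → f a + g a) ≡ ∑ as f + ∑ as g
  ∑-+ [] f g = refl
  ∑-+ (a ∷ as) f g = trans (cong (f a + g a +_) (∑-+ as f g)) (+-interchange (f a) (g a) (∑ as f) (∑ as g))

  ∑-*ʳ : (as : List X) (f : X → ℕ) (c : ℕ) → ∑ as f * c ≡ ∑ as (λ a → f a * c)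
  ∑-*ʳ [] f c = refl
  ∑-*ʳ (a ∷ as) f c = trans (*-distribʳ-+ c (f a) (∑ as f)) (cong (f a * c +_) (∑-*ʳ as f c))

  ∑-≤-length* : (as : List X) (f : X → ℕ) {b : ℕ} → (∀ a → f a ≤ b) → ∑ as f ≤ length as * b
  ∑-≤-length* [] f f≤b = z≤n
  ∑-≤-length* (a ∷ as) f f≤b = +-mono-≤ (f≤b a) (∑-≤-length* as f f≤b)

  ∈⇒≤∑ : (f : X → ℕ) {a : X} {as : List X} → a ∈ₗ as → f a ≤ ∑ as f
  ∈⇒≤∑ f (here refl) = m≤m+n _ _
  ∈⇒≤∑ f {as = b ∷ as} (there a∈as) = ≤-trans (∈⇒≤∑ f a∈as) (m≤n+m _ (f b))

  count-union-bound : {P : Pred X lzero} (P? : Decidable P) {Q : Y → Pred X lzero} (Q? : ∀ b → Decidable (Q b)) →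
    (bs : List Y) → (∀ a → P a → ∃[ b ] b ∈ₗ bs × Q b a) →
    ∀ as → count P? as ≤ ∑ bs (λ b → count (Q? b) as)
  count-union-bound P? Q? bs covered [] = z≤n
  count-union-bound P? Q? bs covered (a ∷ as) = begin
    𝟙 (P? a) + count P? as
      ≤⟨ +-mono-≤ (𝟙-covered (P? a)) (count-union-bound P? Q? bs covered as) ⟩
    ∑ bs (λ b → 𝟙 (Q? b a)) + ∑ bs (λ b → count (Q? b) as) ≡⟨ ∑-+ bs _ _ ⟨
    ∑ bs (λ b → count (Q? b) (a ∷ as))                       ∎
    where
      open ≤-Reasoning
      𝟙-covered : (d : Dec _) → 𝟙 d ≤ ∑ bs (λ b → 𝟙 (Q? b a))
      𝟙-covered (no _) = z≤n
      𝟙-covered (yes p) with covered a p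
      ... | b , b∈bs , q = subst (_≤ _) (𝟙-yes (Q? b a) q) (∈⇒≤∑ (λ b → 𝟙 (Q? b a)) b∈bs)

  C-absorb : ∀ n y → suc y * (suc n C suc y) ≡ suc n * (n C y)
  C-absorb n zero = trans (+-identityʳ (suc n C 1)) (trans (nC1≡n (suc n)) (sym (*-identityʳ (suc n))))
  C-absorb zero (suc y) = *-zeroʳ (suc (suc y))
  C-absorb (suc n) (suc y) = begin
    suc (suc y) * (suc (suc n) C suc (suc y))
      ≡⟨ cong (suc (suc y) *_) (nCk+nC[k+1]≡[n+1]C[k+1] (suc n) (suc y)) ⟨
    suc (suc y) * ((suc n C suc y) + (suc n C suc (suc y)))
      ≡⟨ *-distribˡ-+ (suc (suc y)) (suc n C suc y) _ ⟩
    ((suc n C suc y) + suc y * (suc n C suc y)) + suc (suc y) * (suc n C suc (suc y))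
      ≡⟨ cong₂ (λ a b → ((suc n C suc y) + a) + b) (C-absorb n y) (C-absorb n (suc y)) ⟩
    ((suc n C suc y) + suc n * (n C y)) + suc n * (n C suc y)
      ≡⟨ +-assoc (suc n C suc y) _ _ ⟩
    (suc n C suc y) + (suc n * (n C y) + suc n * (n C suc y))
      ≡⟨ cong ((suc n C suc y) +_) (*-distribˡ-+ (suc n) (n C y) (n C suc y)) ⟨
    (suc n C suc y) + suc n * ((n C y) + (n C suc y))
      ≡⟨ cong (λ a → (suc n C suc y) + suc n * a) (nCk+nC[k+1]≡[n+1]C[k+1] n y) ⟩
    (suc n C suc y) + suc n * (suc n C suc y) ∎
    where open ≡-Reasoning

  ratio-step : ∀ j {n y} → y ≤ n → (n + suc j) * suc y ≤ suc n * (suc j + y)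
  ratio-step j {y = y} y≤n with m≤n⇒∃[o]m+o≡n y≤n
  ... | d , refl = subst ((y + d + suc j) * suc y ≤_) (sym (expand j y d)) (m≤m+n _ (j * d))
    where
      expand : ∀ j y d → suc (y + d) * (suc j + y) ≡ (y + d + suc j) * suc y + j * d
      expand = solve 3 (λ j y d → (con 1 :+ (y :+ d)) :* ((con 1 :+ j) :+ y)
                               := (y :+ d :+ (con 1 :+ j)) :* (con 1 :+ y) :+ j :* d) refl

  -- Induction on j: after multiplying by suc n, absorption turns n C y into suc n C suc y.
  C-ratio : ∀ j n y → (n + j) ^ j * (n C y) ≤ (j + y) ^ j * ((n + j) C (j + y))
  C-ratio zero n y rewrite +-identityʳ n = ≤-refl
  C-ratio (suc j) n y with y ≤? n
  ... | no y≰n = begin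
    M ^ suc j * (n C y) ≡⟨ cong (M ^ suc j *_) (k>n⇒nCk≡0 (≰⇒> y≰n)) ⟩
    M ^ suc j * 0       ≡⟨ *-zeroʳ (M ^ suc j) ⟩
    0                   ≤⟨ z≤n ⟩
    W ^ suc j * (M C W) ∎
    where
      open ≤-Reasoning
      M = n + suc j
      W = suc j + y
  ... | yes y≤n = *-cancelˡ-≤ (suc n) (begin
    suc n * (M * M ^ j * (n C y))                 ≡⟨ reassoc₁ (suc n) M (M ^ j) (n C y) ⟩
    M * M ^ j * (suc n * (n C y))                 ≡⟨ cong (M * M ^ j *_) (C-absorb n y) ⟨
    M * M ^ j * (suc y * (suc n C suc y))         ≡⟨ reassoc₂ M (M ^ j) (suc y) (suc n C suc y) ⟩
    (M * suc y) * (M ^ j * (suc n C suc y))       ≤⟨ *-monoʳ-≤ (M * suc y) ih ⟩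
    (M * suc y) * (W ^ j * (M C W))               ≤⟨ *-monoˡ-≤ _ (ratio-step j y≤n) ⟩
    (suc n * W) * (W ^ j * (M C W))               ≡⟨ reassoc₃ (suc n) W (W ^ j) (M C W) ⟩
    suc n * (W * W ^ j * (M C W))                 ∎)
    where
      open ≤-Reasoning
      M = n + suc j
      W = suc j + y
      ih : M ^ j * (suc n C suc y) ≤ W ^ j * (M C W)
      ih = subst₂ (λ a b → a ^ j * (suc n C suc y) ≤ b ^ j * (a C b)) (sym (+-suc n j)) (+-suc j y)
                  (C-ratio j (suc n) (suc y))
      reassoc₁ : ∀ a b c d → a * (b * c * d) ≡ b * c * (a * d)
      reassoc₁ = solve 4 (λ a b c d → a :* (b :* c :* d) := b :* c :* (a :* d)) refl
      reassoc₂ : ∀ a b c d → a * b * (c * d) ≡ (a * c) * (b * d)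
      reassoc₂ = solve 4 (λ a b c d → a :* b :* (c :* d) := (a :* c) :* (b :* d)) refl
      reassoc₃ : ∀ a b c d → (a * b) * (c * d) ≡ a * (b * c * d)
      reassoc₃ = solve 4 (λ a b c d → (a :* b) :* (c :* d) := a :* (b :* c :* d)) refl

  count-allSubsets-suc : {P : Pred (Subset (suc m)) lzero} (P? : Decidable P) →
    count P? (allSubsets (suc m)) ≡ count (P? ∘ (inside ∷_)) (allSubsets m) + count (P? ∘ (outside ∷_)) (allSubsets m)
  count-allSubsets-suc {m} P? = begin
    count P? (map (inside ∷_) (allSubsets m) ++ map (outside ∷_) (allSubsets m))
      ≡⟨ count-++ P? (map (inside ∷_) (allSubsets m)) _ ⟩
    count P? (map (inside ∷_) (allSubsets m)) + count P? (map (outside ∷_) (allSubsets m))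
      ≡⟨ cong₂ _+_ (count-map P? (inside ∷_) (allSubsets m)) (count-map P? (outside ∷_) (allSubsets m)) ⟩
    count (P? ∘ (inside ∷_)) (allSubsets m) + count (P? ∘ (outside ∷_)) (allSubsets m) ∎
    where open ≡-Reasoning

  SupersetOfSize : Subset m → ℕ → Subset m → Set
  SupersetOfSize A x S = ∣ S ∣ ≡ x × A ⊆ S

  supersetOfSize? : (A : Subset m) (x : ℕ) → Decidable (SupersetOfSize A x)
  supersetOfSize? A x S = (∣ S ∣ ≟ x) ×-dec (A ⊆? S)

  #supersets : Subset m → ℕ → ℕ
  #supersets {m} A x = count (supersetOfSize? A x) (allSubsets m)

  #supersetsWith : Side → Subset (suc m) → ℕ → ℕ
  #supersetsWith {m} s A x = count (λ S → supersetOfSize? A x (s ∷ S)) (allSubsets m)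

  #supersets-∷ : (A : Subset (suc m)) (x : ℕ) → #supersets A x ≡ #supersetsWith inside A x + #supersetsWith outside A x
  #supersets-∷ A x = count-allSubsets-suc (supersetOfSize? A x)

  #supersets-< : (A : Subset m) {x : ℕ} → x < ∣ A ∣ → #supersets A x ≡ 0
  #supersets-< {m} A x<∣A∣ = count-none (supersetOfSize? A _) too-small (allSubsets m)
    where
      too-small : ∀ S → ¬ SupersetOfSize A _ S
      too-small S (refl , A⊆S) = <⇒≱ x<∣A∣ (p⊆q⇒∣p∣≤∣q∣ A⊆S)

  module _ (b : Side) (A : Subset m) where

    #supersetsWith-inside-suc : ∀ x → #supersetsWith inside (b ∷ A) (suc x) ≡ #supersets A x
    #supersetsWith-inside-suc x = count-cong _ (supersetOfSize? A x) drop-inside add-inside (allSubsets m)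
      where
        drop-inside : ∀ S → SupersetOfSize (b ∷ A) (suc x) (inside ∷ S) → SupersetOfSize A x S
        drop-inside S (∣S∣≡x , ⊆S) = suc-injective ∣S∣≡x , drop-∷-⊆ ⊆S
        add-inside : ∀ S → SupersetOfSize A x S → SupersetOfSize (b ∷ A) (suc x) (inside ∷ S)
        add-inside S (∣S∣≡x , A⊆S) = cong suc ∣S∣≡x , ∷⊆inside∷ b
          where
            ∷⊆inside∷ : ∀ b → b ∷ A ⊆ inside ∷ S
            ∷⊆inside∷ inside = in⊆in A⊆S
            ∷⊆inside∷ outside = out⊆ A⊆S

    #supersetsWith-inside-≤ : ∀ {x} → x ≤ ∣ A ∣ → #supersetsWith inside (b ∷ A) x ≡ 0
    #supersetsWith-inside-≤ x≤∣A∣ = count-none _ too-small (allSubsets m)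
      where
        too-small : ∀ S → ¬ SupersetOfSize (b ∷ A) _ (inside ∷ S)
        too-small S (refl , ⊆S) = <⇒≱ (s≤s (p⊆q⇒∣p∣≤∣q∣ (drop-∷-⊆ ⊆S))) x≤∣A∣

  #supersetsWith-outside-inside : (A : Subset m) (x : ℕ) → #supersetsWith outside (inside ∷ A) x ≡ 0
  #supersetsWith-outside-inside {m} A x = count-none _ (λ S (_ , ⊆S) → case ⊆S here of λ ()) (allSubsets m)

  #supersetsWith-outside-outside : (A : Subset m) (x : ℕ) → #supersetsWith outside (outside ∷ A) x ≡ #supersets A x
  #supersetsWith-outside-outside {m} A x = count-cong _ (supersetOfSize? A x) drop-outside add-outside (allSubsets m)
    where
      drop-outside : ∀ S → SupersetOfSize (outside ∷ A) x (outside ∷ S) → SupersetOfSize A x S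
      drop-outside S (∣S∣≡x , ⊆S) = ∣S∣≡x , drop-∷-⊆ ⊆S
      add-outside : ∀ S → SupersetOfSize A x S → SupersetOfSize (outside ∷ A) x (outside ∷ S)
      add-outside S (∣S∣≡x , A⊆S) = ∣S∣≡x , out⊆ A⊆S

  #supersets-+ : (A : Subset m) (y : ℕ) → #supersets A (∣ A ∣ + y) ≡ (m ∸ ∣ A ∣) C y
  #supersets-+ [] zero = refl
  #supersets-+ [] (suc y) = refl
  #supersets-+ {suc m} (inside ∷ A) y = begin
    #supersets (inside ∷ A) (suc (∣ A ∣ + y))     ≡⟨ #supersets-∷ (inside ∷ A) _ ⟩
    #supersetsWith inside (inside ∷ A) (suc (∣ A ∣ + y)) + #supersetsWith outside (inside ∷ A) _
      ≡⟨ cong₂ _+_ (#supersetsWith-inside-suc inside A (∣ A ∣ + y)) (#supersetsWith-outside-inside A _) ⟩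
    #supersets A (∣ A ∣ + y) + 0                   ≡⟨ +-identityʳ _ ⟩
    #supersets A (∣ A ∣ + y)                       ≡⟨ #supersets-+ A y ⟩
    (m ∸ ∣ A ∣) C y                                ∎
    where open ≡-Reasoning
  #supersets-+ {suc m} (outside ∷ A) zero = begin
    #supersets (outside ∷ A) (∣ A ∣ + 0)           ≡⟨ #supersets-∷ (outside ∷ A) _ ⟩
    #supersetsWith inside (outside ∷ A) (∣ A ∣ + 0) + #supersetsWith outside (outside ∷ A) (∣ A ∣ + 0)
      ≡⟨ cong₂ _+_ (#supersetsWith-inside-≤ outside A (≤-reflexive (+-identityʳ ∣ A ∣)))
                   (#supersetsWith-outside-outside A _) ⟩
    #supersets A (∣ A ∣ + 0)                       ≡⟨ #supersets-+ A 0 ⟩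
    1                                              ∎
    where open ≡-Reasoning
  #supersets-+ {suc m} (outside ∷ A) (suc y) = begin
    #supersets (outside ∷ A) (∣ A ∣ + suc y)       ≡⟨ #supersets-∷ (outside ∷ A) _ ⟩
    #supersetsWith inside (outside ∷ A) (∣ A ∣ + suc y) + #supersetsWith outside (outside ∷ A) (∣ A ∣ + suc y)
      ≡⟨ cong₂ _+_ inside-part (#supersetsWith-outside-outside A _) ⟩
    #supersets A (∣ A ∣ + y) + #supersets A (∣ A ∣ + suc y)
      ≡⟨ cong₂ _+_ (#supersets-+ A y) (#supersets-+ A (suc y)) ⟩
    ((m ∸ ∣ A ∣) C y) + ((m ∸ ∣ A ∣) C suc y)      ≡⟨ nCk+nC[k+1]≡[n+1]C[k+1] (m ∸ ∣ A ∣) y ⟩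
    suc (m ∸ ∣ A ∣) C suc y                        ≡⟨ cong (λ n → n C suc y) (+-∸-assoc 1 (∣p∣≤n A)) ⟨
    (suc m ∸ ∣ A ∣) C suc y                        ∎
    where
      open ≡-Reasoning
      inside-part : #supersetsWith inside (outside ∷ A) (∣ A ∣ + suc y) ≡ #supersets A (∣ A ∣ + y)
      inside-part rewrite +-suc ∣ A ∣ y = #supersetsWith-inside-suc outside A (∣ A ∣ + y)

  #supersets-⊥ : ∀ m x → #supersets (⊥ {m}) x ≡ m C x
  #supersets-⊥ m x =
    subst (λ a → #supersets (⊥ {m}) (a + x) ≡ (m ∸ a) C x) (∣⊥∣≡0 m) (#supersets-+ (⊥ {m}) x)

  #supersets-bound : (A : Subset m) (x : ℕ) → m ^ ∣ A ∣ * #supersets A x ≤ x ^ ∣ A ∣ * (m C x)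
  #supersets-bound {m} A x with x <? ∣ A ∣
  ... | yes x<∣A∣ rewrite #supersets-< A x<∣A∣ | *-zeroʳ (m ^ ∣ A ∣) = z≤n
  ... | no x≮∣A∣ with m≤n⇒∃[o]m+o≡n (≮⇒≥ x≮∣A∣)
  ...   | y , refl rewrite #supersets-+ A y =
    subst (λ n → n ^ ∣ A ∣ * ((m ∸ ∣ A ∣) C y) ≤ (∣ A ∣ + y) ^ ∣ A ∣ * (n C (∣ A ∣ + y)))
          (m∸n+n≡m (∣p∣≤n A)) (C-ratio ∣ A ∣ (m ∸ ∣ A ∣) y)

  prodℕ-cong : {f g : Fin k → ℕ} → (∀ v → f v ≡ g v) → prodℕ f ≡ prodℕ g
  prodℕ-cong {zero} f≡g = refl
  prodℕ-cong {suc k} f≡g = cong₂ _*_ (f≡g F.zero) (prodℕ-cong (f≡g ∘ F.suc))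

  prodℕ-mono-≤ : {f g : Fin k → ℕ} → (∀ v → f v ≤ g v) → prodℕ f ≤ prodℕ g
  prodℕ-mono-≤ {zero} f≤g = ≤-refl
  prodℕ-mono-≤ {suc k} f≤g = *-mono-≤ (f≤g F.zero) (prodℕ-mono-≤ (f≤g ∘ F.suc))

  prodℕ-* : (f g : Fin k → ℕ) → prodℕ (λ v → f v * g v) ≡ prodℕ f * prodℕ g
  prodℕ-* {zero} f g = refl
  prodℕ-* {suc k} f g = trans (cong (f F.zero * g F.zero *_) (prodℕ-* (f ∘ F.suc) (g ∘ F.suc)))
                              ([m*n]*[o*p]≡[m*o]*[n*p] (f F.zero) (g F.zero) _ _)

  prodℕ-const : (k c : ℕ) → prodℕ {k} (λ _ → c) ≡ c ^ k
  prodℕ-const zero c = refl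
  prodℕ-const (suc k) c = cong (c *_) (prodℕ-const k c)

  prodℕ-^ : (f : Fin k → ℕ) (n : ℕ) → prodℕ (λ v → f v ^ n) ≡ prodℕ f ^ n
  prodℕ-^ {k} f zero = trans (prodℕ-const k 1) (^-zeroˡ k)
  prodℕ-^ f (suc n) = trans (prodℕ-* f (λ v → f v ^ n)) (cong (prodℕ f *_) (prodℕ-^ f n))

  HasSizes : ℕ → Vec (Subset m) k → Set
  HasSizes L A = ∀ v → ∣ lookup A v ∣ ≡ L

  Fits : (Fin k → ℕ) → Vec (Subset m) k → Vec (Subset m) k → Set
  Fits x A S = ∀ v → SupersetOfSize (lookup A v) (x v) (lookup S v)

  fits? : (x : Fin k → ℕ) (A : Vec (Subset m) k) → Decidable (Fits x A)
  fits? x A S = all? (λ v → supersetOfSize? (lookup A v) (x v) (lookup S v))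

  count-Fits : ∀ k (x : Fin k → ℕ) (A : Vec (Subset m) k) →
    count (fits? x A) (allTuples m k) ≡ prodℕ (λ v → #supersets (lookup A v) (x v))
  count-Fits {m} zero x [] = 𝟙-yes (fits? {m = m} x [] []) (λ ())
  count-Fits {m} (suc k) x (a ∷ A) = begin
    count (fits? x (a ∷ A)) (allTuples m (suc k))
      ≡⟨ cong (count (fits? x (a ∷ A))) (concatMap-map≡cartesianProductWith _∷_ (allSubsets m) (allTuples m k)) ⟩
    count (fits? x (a ∷ A)) (cartesianProductWith _∷_ (allSubsets m) (allTuples m k))
      ≡⟨ count-cartesianProductWith (fits? x (a ∷ A)) (supersetOfSize? a (x F.zero)) (fits? (x ∘ F.suc) A)
           _∷_ (λ S Ss → mk⇔ split join) (allSubsets m) (allTuples m k) ⟩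
    #supersets a (x F.zero) * count (fits? (x ∘ F.suc) A) (allTuples m k)
      ≡⟨ cong (#supersets a (x F.zero) *_) (count-Fits k (x ∘ F.suc) A) ⟩
    prodℕ (λ v → #supersets (lookup (a ∷ A) v) (x v)) ∎
    where
      open ≡-Reasoning
      split : ∀ {S Ss} → Fits x (a ∷ A) (S ∷ Ss) → SupersetOfSize a (x F.zero) S × Fits (x ∘ F.suc) A Ss
      split fits = fits F.zero , fits ∘ F.suc
      join : ∀ {S Ss} → SupersetOfSize a (x F.zero) S × Fits (x ∘ F.suc) A Ss → Fits x (a ∷ A) (S ∷ Ss)
      join (fits₀ , fits₊) F.zero = fits₀
      join (fits₀ , fits₊) (F.suc v) = fits₊ v

  replicate-⊥-⊆ : (S : Vec (Subset m) k) (v : Fin k) → lookup (replicate k ⊥) v ⊆ lookup S v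
  replicate-⊥-⊆ S v = subst (_⊆ lookup S v) (sym (lookup-replicate v ⊥)) (⊆-min (lookup S v))

  count-SizesAre : ∀ k m (x : Fin k → ℕ) (B? : Decidable (SizesAre {k} {m} x)) →
    count B? (allTuples m k) ≡ prodℕ (λ v → m C x v)
  count-SizesAre k m x B? = begin
    count B? (allTuples m k)
      ≡⟨ count-cong B? (fits? x ⊥s) (λ S sizes v → sizes v , replicate-⊥-⊆ S v) (λ S fits → proj₁ ∘ fits)
                    (allTuples m k) ⟩
    count (fits? x ⊥s) (allTuples m k)
      ≡⟨ count-Fits k x ⊥s ⟩
    prodℕ (λ v → #supersets (lookup ⊥s v) (x v))
      ≡⟨ prodℕ-cong (λ v → trans (cong (λ A → #supersets A (x v)) (lookup-replicate v (⊥ {m})))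
                                 (#supersets-⊥ m (x v))) ⟩
    prodℕ (λ v → m C x v) ∎
    where
      open ≡-Reasoning
      ⊥s = replicate k (⊥ {m})

  count-Fits-bound : ∀ k (x : Fin k → ℕ) (A : Vec (Subset m) k) (L : ℕ) → HasSizes L A →
    count (fits? x A) (allTuples m k) * m ^ (L * k) ≤ prodℕ x ^ L * prodℕ (λ v → m C x v)
  count-Fits-bound {m} k x A L ∣A∣≡L = begin
    count (fits? x A) (allTuples m k) * m ^ (L * k)
      ≡⟨ cong₂ _*_ (count-Fits k x A) (trans (sym (^-*-assoc m L k)) (sym (prodℕ-const k (m ^ L)))) ⟩
    prodℕ (λ v → #supersets (lookup A v) (x v)) * prodℕ {k} (λ _ → m ^ L)
      ≡⟨ prodℕ-* (λ v → #supersets (lookup A v) (x v)) (λ _ → m ^ L) ⟨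
    prodℕ (λ v → #supersets (lookup A v) (x v) * m ^ L)
      ≤⟨ prodℕ-mono-≤ bound ⟩
    prodℕ (λ v → x v ^ L * (m C x v))
      ≡⟨ prodℕ-* (λ v → x v ^ L) (λ v → m C x v) ⟩
    prodℕ (λ v → x v ^ L) * prodℕ (λ v → m C x v)
      ≡⟨ cong (_* prodℕ (λ v → m C x v)) (prodℕ-^ x L) ⟩
    prodℕ x ^ L * prodℕ (λ v → m C x v) ∎
    where
      open ≤-Reasoning
      bound : ∀ v → #supersets (lookup A v) (x v) * m ^ L ≤ x v ^ L * (m C x v)
      bound v rewrite *-comm (#supersets (lookup A v) (x v)) (m ^ L) | sym (∣A∣≡L v) =
        #supersets-bound (lookup A v) (x v)

  ∣p∪⁅x⁆∣ : (p : Subset m) (x : Fin m) → x ∉ p → ∣ p ∪ ⁅ x ⁆ ∣ ≡ suc ∣ p ∣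
  ∣p∪⁅x⁆∣ (inside ∷ p) F.zero x∉p = ⊥-elim (x∉p here)
  ∣p∪⁅x⁆∣ (outside ∷ p) F.zero x∉p = cong (suc ∘ ∣_∣) (∪-identityʳ p)
  ∣p∪⁅x⁆∣ (inside ∷ p) (F.suc x) x∉p = cong suc (∣p∪⁅x⁆∣ p x (x∉p ∘ there))
  ∣p∪⁅x⁆∣ (outside ∷ p) (F.suc x) x∉p = ∣p∪⁅x⁆∣ p x (x∉p ∘ there)

  p∪⁅x⁆⊆q : {p q : Subset m} {x : Fin m} → p ⊆ q → x ∈ q → p ∪ ⁅ x ⁆ ⊆ q
  p∪⁅x⁆⊆q {p = p} {x = x} p⊆q x∈q {y} y∈ with x∈p∪q⁻ p ⁅ x ⁆ y∈
  ... | inj₁ y∈p = p⊆q y∈p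
  ... | inj₂ y∈⁅x⁆ rewrite x∈⁅y⁆⇒x≡y x y∈⁅x⁆ = x∈q

  insertAll : Subset m → Vec (Fin m) n → Subset m
  insertAll p [] = p
  insertAll p (x ∷ xs) = insertAll (p ∪ ⁅ x ⁆) xs

  insertAll-⊆ : {p q : Subset m} (xs : Vec (Fin m) n) → p ⊆ q → (∀ i → lookup xs i ∈ q) →
    insertAll p xs ⊆ q
  insertAll-⊆ [] p⊆q xs⊆q = p⊆q
  insertAll-⊆ (x ∷ xs) p⊆q xs⊆q = insertAll-⊆ xs (p∪⁅x⁆⊆q p⊆q (xs⊆q F.zero)) (xs⊆q ∘ F.suc)

  ∣insertAll∣ : (p : Subset m) (xs : Vec (Fin m) n) → (∀ i → lookup xs i ∉ p) →
    (∀ i j → lookup xs i ≡ lookup xs j → i ≡ j) → ∣ insertAll p xs ∣ ≡ ∣ p ∣ + n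
  ∣insertAll∣ p [] fresh distinct = sym (+-identityʳ ∣ p ∣)
  ∣insertAll∣ {n = suc n} p (x ∷ xs) fresh distinct = begin
    ∣ insertAll (p ∪ ⁅ x ⁆) xs ∣ ≡⟨ ∣insertAll∣ (p ∪ ⁅ x ⁆) xs fresh′ distinct′ ⟩
    ∣ p ∪ ⁅ x ⁆ ∣ + n             ≡⟨ cong (_+ n) (∣p∪⁅x⁆∣ p x (fresh F.zero)) ⟩
    suc ∣ p ∣ + n                 ≡⟨ +-suc ∣ p ∣ n ⟨
    ∣ p ∣ + suc n                 ∎
    where
      open ≡-Reasoning
      distinct′ : ∀ i j → lookup xs i ≡ lookup xs j → i ≡ j
      distinct′ i j = Fin-suc-injective ∘ distinct (F.suc i) (F.suc j)
      fresh′ : ∀ i → lookup xs i ∉ p ∪ ⁅ x ⁆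
      fresh′ i y∈ with x∈p∪q⁻ p ⁅ x ⁆ y∈
      ... | inj₁ y∈p = fresh (F.suc i) y∈p
      ... | inj₂ y∈⁅x⁆ with distinct (F.suc i) F.zero (x∈⁅y⁆⇒x≡y x y∈⁅x⁆)
      ...   | ()

  -- An attribute for every pair {u, v}, u < v, of k vertices: the vector holds those of the
  -- pairs {0, v + 1}, the rest is an assignment for the vertices 1, …, k - 1.
  Assignment : ℕ → ℕ → Set
  Assignment m zero = ⊤
  Assignment m (suc k) = Vec (Fin m) k × Assignment m k

  insertEach : Vec (Subset m) k → Vec (Fin m) k → Vec (Subset m) k
  insertEach = zipWith (λ p x → p ∪ ⁅ x ⁆)

  lookup-insertEach : (ps : Vec (Subset m) k) (xs : Vec (Fin m) k) (v : Fin k) →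
    lookup (insertEach ps xs) v ≡ lookup ps v ∪ ⁅ lookup xs v ⁆
  lookup-insertEach ps xs v = lookup-zipWith _ v ps xs

  -- requiredSets D c v is D v together with the attributes c puts on the pairs containing v.
  requiredSets : Vec (Subset m) k → Assignment m k → Vec (Subset m) k
  requiredSets [] tt = []
  requiredSets (p ∷ ps) (xs , c) = insertAll p xs ∷ requiredSets (insertEach ps xs) c

  dropVertex : (Fin (suc k) → Fin (suc k) → Fin m) → Fin k → Fin k → Fin m
  dropVertex f u v = f (F.suc u) (F.suc v)

  fromPairing : (Fin k → Fin k → Fin m) → Assignment m k
  fromPairing {zero} f = tt
  fromPairing {suc k} f = tabulate (f F.zero ∘ F.suc) , fromPairing (dropVertex f)

  requiredSets-⊆ : (f : Fin k → Fin k → Fin m) (D S : Vec (Subset m) k) →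
    (∀ u v → u F.< v → f u v ∈ lookup S u × f u v ∈ lookup S v) → (∀ v → lookup D v ⊆ lookup S v) →
    ∀ v → lookup (requiredSets D (fromPairing f)) v ⊆ lookup S v
  requiredSets-⊆ f (d ∷ D) (S ∷ Ss) f∈S D⊆S F.zero = insertAll-⊆ xs (D⊆S F.zero) xs⊆S
    where
      xs = tabulate (f F.zero ∘ F.suc)
      xs⊆S : ∀ i → lookup xs i ∈ S
      xs⊆S i rewrite lookup∘tabulate (f F.zero ∘ F.suc) i = proj₁ (f∈S F.zero (F.suc i) z<s)
  requiredSets-⊆ f (d ∷ D) (S ∷ Ss) f∈S D⊆S (F.suc v) =
    requiredSets-⊆ (dropVertex f) D′ Ss (λ u w u<w → f∈S (F.suc u) (F.suc w) (s<s u<w)) D′⊆S v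
    where
      xs = tabulate (f F.zero ∘ F.suc)
      D′ = insertEach D xs
      D′⊆S : ∀ v → lookup D′ v ⊆ lookup Ss v
      D′⊆S v rewrite lookup-insertEach D xs v | lookup∘tabulate (f F.zero ∘ F.suc) v =
        p∪⁅x⁆⊆q (D⊆S (F.suc v)) (proj₂ (f∈S F.zero (F.suc v) z<s))

  PairInjective : (Fin k → Fin k → Fin m) → Set
  PairInjective f = ∀ u v u′ v′ → u F.< v → u′ F.< v′ → f u v ≡ f u′ v′ → u ≡ u′ × v ≡ v′

  Avoids : Vec (Subset m) k → (Fin k → Fin k → Fin m) → Set
  Avoids D f = ∀ v {a} → a ∈ lookup D v → ∀ u w → u F.< w → a ≢ f u w

  ∣requiredSets∣ : (f : Fin k → Fin k → Fin m) (D : Vec (Subset m) k) → PairInjective f → Avoids D f →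
    ∀ v → ∣ lookup (requiredSets D (fromPairing f)) v ∣ ≡ ∣ lookup D v ∣ + (k ∸ 1)
  ∣requiredSets∣ f (d ∷ D) inj avoids F.zero = ∣insertAll∣ d xs fresh distinct
    where
      xs = tabulate (f F.zero ∘ F.suc)
      xs-lookup : ∀ i → lookup xs i ≡ f F.zero (F.suc i)
      xs-lookup = lookup∘tabulate (f F.zero ∘ F.suc)
      fresh : ∀ i → lookup xs i ∉ d
      fresh i x∈d = avoids F.zero x∈d F.zero (F.suc i) z<s (xs-lookup i)
      distinct : ∀ i j → lookup xs i ≡ lookup xs j → i ≡ j
      distinct i j eq = Fin-suc-injective (proj₂ (inj F.zero (F.suc i) F.zero (F.suc j) z<s z<s
                          (trans (sym (xs-lookup i)) (trans eq (xs-lookup j)))))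
  ∣requiredSets∣ {suc (suc k)} f (d ∷ D) inj avoids (F.suc v) = begin
    ∣ lookup (requiredSets D′ (fromPairing f₊)) v ∣ ≡⟨ ∣requiredSets∣ f₊ D′ inj₊ avoids₊ v ⟩
    ∣ lookup D′ v ∣ + k                             ≡⟨ cong (_+ k) ∣D′∣ ⟩
    suc ∣ lookup D v ∣ + k                          ≡⟨ +-suc _ k ⟨
    ∣ lookup D v ∣ + suc k                          ∎
    where
      open ≡-Reasoning
      xs = tabulate (f F.zero ∘ F.suc)
      xs-lookup : ∀ i → lookup xs i ≡ f F.zero (F.suc i)
      xs-lookup = lookup∘tabulate (f F.zero ∘ F.suc)
      f₊ = dropVertex f
      D′ = insertEach D xs
      ∣D′∣ : ∣ lookup D′ v ∣ ≡ suc ∣ lookup D v ∣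
      ∣D′∣ rewrite lookup-insertEach D xs v =
        ∣p∪⁅x⁆∣ (lookup D v) (lookup xs v) (λ x∈D → avoids (F.suc v) x∈D F.zero (F.suc v) z<s (xs-lookup v))
      inj₊ : PairInjective f₊
      inj₊ u w u′ w′ u<w u′<w′ eq with inj (F.suc u) (F.suc w) (F.suc u′) (F.suc w′) (s<s u<w) (s<s u′<w′) eq
      ... | u≡u′ , w≡w′ = Fin-suc-injective u≡u′ , Fin-suc-injective w≡w′
      avoids₊ : Avoids D′ f₊
      avoids₊ v′ {a} a∈D′ u w u<w a≡f₊uw
        with x∈p∪q⁻ (lookup D v′) ⁅ lookup xs v′ ⁆ (subst (a ∈_) (lookup-insertEach D xs v′) a∈D′)
      ... | inj₁ a∈D = avoids (F.suc v′) a∈D (F.suc u) (F.suc w) (s<s u<w) a≡f₊uw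
      ... | inj₂ a∈⁅x⁆ with inj F.zero (F.suc v′) (F.suc u) (F.suc w) z<s (s<s u<w)
                               (trans (sym (xs-lookup v′)) (trans (sym (x∈⁅y⁆⇒x≡y _ a∈⁅x⁆)) a≡f₊uw))
      ...   | () , _

  allVecs : ∀ m n → List (Vec (Fin m) n)
  allVecs m zero = [ [] ]
  allVecs m (suc n) = cartesianProductWith _∷_ (allFin m) (allVecs m n)

  allAssignments : ∀ m k → List (Assignment m k)
  allAssignments m zero = [ tt ]
  allAssignments m (suc k) = cartesianProductWith _,_ (allVecs m k) (allAssignments m k)

  ∈-allVecs : ∀ {n} (xs : Vec (Fin m) n) → xs ∈ₗ allVecs m n
  ∈-allVecs [] = here refl
  ∈-allVecs (x ∷ xs) = ∈-cartesianProductWith⁺ _∷_ (∈-allFin x) (∈-allVecs xs)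

  ∈-allAssignments : ∀ k (c : Assignment m k) → c ∈ₗ allAssignments m k
  ∈-allAssignments zero tt = here refl
  ∈-allAssignments (suc k) (xs , c) = ∈-cartesianProductWith⁺ _,_ (∈-allVecs xs) (∈-allAssignments k c)

  length-allVecs : ∀ m n → length (allVecs m n) ≡ m ^ n
  length-allVecs m zero = refl
  length-allVecs m (suc n) = trans (length-cartesianProductWith _∷_ (allFin m) (allVecs m n))
                                   (cong₂ _*_ (length-tabulate {n = m} (λ i → i)) (length-allVecs m n))

  pairs : ℕ → ℕ
  pairs zero = 0
  pairs (suc k) = k + pairs k

  length-allAssignments : ∀ m k → length (allAssignments m k) ≡ m ^ pairs k
  length-allAssignments m zero = refl
  length-allAssignments m (suc k) = begin
    length (cartesianProductWith _,_ (allVecs m k) (allAssignments m k))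
      ≡⟨ length-cartesianProductWith _,_ (allVecs m k) _ ⟩
    length (allVecs m k) * length (allAssignments m k)
      ≡⟨ cong₂ _*_ (length-allVecs m k) (length-allAssignments m k) ⟩
    m ^ k * m ^ pairs k ≡⟨ ^-distribˡ-+-* m k (pairs k) ⟨
    m ^ (k + pairs k)   ∎
    where open ≡-Reasoning

  pairs-double : ∀ k → pairs k + pairs k ≡ k * (k ∸ 1)
  pairs-double zero = refl
  pairs-double (suc zero) = refl
  pairs-double (suc (suc k)) = begin
    (suc k + pairs (suc k)) + (suc k + pairs (suc k)) ≡⟨ +-interchange (suc k) (pairs (suc k)) _ _ ⟩
    (suc k + suc k) + (pairs (suc k) + pairs (suc k)) ≡⟨ cong (suc k + suc k +_) (pairs-double (suc k)) ⟩
    (suc k + suc k) + suc k * k                       ≡⟨ regroup (suc k) k ⟩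
    suc (suc k) * suc k                               ∎
    where
      open ≡-Reasoning
      regroup : ∀ a k → (a + a) + a * k ≡ (2 + k) * a
      regroup = solve 2 (λ a k → (a :+ a) :+ a :* k := (con 2 :+ k) :* a) refl

  pairs≡ : ∀ k → k * (k ∸ 1) / 2 ≡ pairs k
  pairs≡ k = begin
    k * (k ∸ 1) / 2         ≡⟨ cong (_/ 2) (pairs-double k) ⟨
    (pairs k + pairs k) / 2 ≡⟨ cong (λ p → (pairs k + p) / 2) (+-identityʳ (pairs k)) ⟨
    2 * pairs k / 2         ≡⟨ cong (_/ 2) (*-comm 2 (pairs k)) ⟩
    pairs k * 2 / 2         ≡⟨ m*n/n≡m (pairs k) 2 ⟩
    pairs k                 ∎
    where open ≡-Reasoning
  required : Assignment m k → Vec (Subset m) k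
  required {k = k} = requiredSets (replicate k ⊥)

  Realises : (Fin k → ℕ) → Assignment m k → Vec (Subset m) k → Set
  Realises {k} x c S = HasSizes (k ∸ 1) (required c) × Fits x (required c) S

  realises? : (x : Fin k → ℕ) (c : Assignment m k) → Decidable (Realises x c)
  realises? {k} x c S = all? (λ v → ∣ lookup (required c) v ∣ ≟ k ∸ 1) ×-dec fits? x (required c) S

  rainbow⇒realised : (x : Fin k → ℕ) (S : Vec (Subset m) k) → Rainbow S → SizesAre x S →
    ∃[ c ] c ∈ₗ allAssignments m k × Realises x c S
  rainbow⇒realised {k} {m} x S (f , f∈S , inj) sizes =
    fromPairing f , ∈-allAssignments k (fromPairing f) , sized , fits
    where
      ⊥s = replicate k (⊥ {m})
      avoids : Avoids ⊥s f
      avoids v a∈⊥s = ⊥-elim (∉⊥ (subst (_ ∈_) (lookup-replicate v ⊥) a∈⊥s))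
      sized : HasSizes (k ∸ 1) (required (fromPairing f))
      sized v rewrite ∣requiredSets∣ f ⊥s inj avoids v | lookup-replicate v (⊥ {m}) | ∣⊥∣≡0 m = refl
      fits : Fits x (required (fromPairing f)) S
      fits v = sizes v , requiredSets-⊆ f ⊥s S f∈S (replicate-⊥-⊆ S) v

  count-Realises-bound : ∀ k (x : Fin k → ℕ) (c : Assignment m k) →
    count (realises? x c) (allTuples m k) * m ^ ((k ∸ 1) * k) ≤ prodℕ x ^ (k ∸ 1) * prodℕ (λ v → m C x v)
  count-Realises-bound {m} k x c = by-size (all? (λ v → ∣ lookup (required c) v ∣ ≟ k ∸ 1))
    where
      by-size : Dec (HasSizes (k ∸ 1) (required c)) →
        count (realises? x c) (allTuples m k) * m ^ ((k ∸ 1) * k) ≤ prodℕ x ^ (k ∸ 1) * prodℕ (λ v → m C x v)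
      by-size (yes sized)
        rewrite count-cong (realises? x c) (fits? x (required c)) (λ S → proj₂) (λ S → sized ,_) (allTuples m k) =
          count-Fits-bound k x (required c) (k ∸ 1) sized
      by-size (no ¬sized) rewrite count-none (realises? x c) (λ S → ¬sized ∘ proj₁) (allTuples m k) = z≤n

  rainbow-count-bound : ∀ k m .{{_ : NonZero m}} (x : Fin k → ℕ)
    (R? : Decidable (Rainbow {k} {m})) (B? : Decidable (SizesAre {k} {m} x)) →
    count (∩-dec R? B?) (allTuples m k) * m ^ (k * (k ∸ 1) / 2) ≤ prodℕ x ^ (k ∸ 1) * count B? (allTuples m k)
  rainbow-count-bound k m x R? B? rewrite pairs≡ k = *-cancelˡ-≤ M {{m^n≢0 m (pairs k)}} (begin
    M * (N * M)         ≡⟨ cong (M *_) (*-comm N M) ⟩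
    M * (M * N)         ≡⟨ *-assoc M M N ⟨
    M * M * N           ≡⟨ cong (_* N) M*M≡ ⟩
    m ^ (L * k) * N     ≡⟨ *-comm (m ^ (L * k)) N ⟩
    N * m ^ (L * k)     ≤⟨ *-monoˡ-≤ (m ^ (L * k)) union-bound ⟩
    ∑ cs (λ c → count (realises? x c) S*) * m ^ (L * k)
      ≡⟨ ∑-*ʳ cs (λ c → count (realises? x c) S*) (m ^ (L * k)) ⟩
    ∑ cs (λ c → count (realises? x c) S* * m ^ (L * k))
      ≤⟨ ∑-≤-length* cs _ (count-Realises-bound k x) ⟩
    length cs * (prodℕ x ^ L * prodℕ (λ v → m C x v))
      ≡⟨ cong₂ (λ a b → a * (prodℕ x ^ L * b)) (length-allAssignments m k) (sym (count-SizesAre k m x B?)) ⟩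
    M * (prodℕ x ^ L * count B? S*) ∎)
    where
      open ≤-Reasoning
      L = k ∸ 1
      M = m ^ pairs k
      S* = allTuples m k
      cs = allAssignments m k
      N = count (∩-dec R? B?) S*
      M*M≡ : M * M ≡ m ^ (L * k)
      M*M≡ = trans (sym (^-distribˡ-+-* m (pairs k) (pairs k))) (cong (m ^_) (trans (pairs-double k) (*-comm k L)))
      union-bound : N ≤ ∑ cs (λ c → count (realises? x c) S*)
      union-bound = count-union-bound (∩-dec R? B?) (realises? x) cs (λ S (r , b) → rainbow⇒realised x S r b) S*

open Counting using (count; rainbow-count-bound)

open import Data.Nat as ℕ using (ℕ; zero; suc; NonZero; _∸_; _^_)
open import Data.Nat.DivMod as ℕD using ()
open import Data.Nat.Properties using (m^n≢0)
import Data.Nat.Properties as ℕP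
open import Data.Integer using (+_)
import Data.Integer as ℤ
import Data.Integer.Properties as ℤP
open import Data.Rational as ℚ using (ℚ; 0ℚ; 1ℚ; _≤_; _<_; _+_; _*_; 1/_)
import Data.Rational.Properties as ℚ
import Data.Rational.Unnormalised as ℚᵘ
import Data.Rational.Unnormalised.Properties as ℚᵘ

fromℕ : ℕ → ℚ
fromℕ n = + n ℚ./ 1

fromℕ-suc : ∀ n → fromℕ (suc n) ≡ 1ℚ + fromℕ n
fromℕ-suc n = ℚ.toℚᵘ-injective (begin
  ℚ.toℚᵘ (fromℕ (suc n))               ≈⟨ ℚ.toℚᵘ-fromℚᵘ (ℚᵘ.mkℚᵘ (+ suc n) 0) ⟩
  ℚᵘ.mkℚᵘ (+ suc n) 0                  ≈⟨ ℚᵘ.*≡* (trans (ℤP.*-identityʳ (+ suc n)) (sym 1+n≡)) ⟩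
  ℚᵘ.mkℚᵘ (+ 1) 0 ℚᵘ.+ ℚᵘ.mkℚᵘ (+ n) 0 ≈⟨ ℚᵘ.+-cong (ℚᵘ.≃-sym (ℚ.toℚᵘ-fromℚᵘ (ℚᵘ.mkℚᵘ (+ 1) 0)))
                                                  (ℚᵘ.≃-sym (ℚ.toℚᵘ-fromℚᵘ (ℚᵘ.mkℚᵘ (+ n) 0))) ⟩
  ℚ.toℚᵘ 1ℚ ℚᵘ.+ ℚ.toℚᵘ (fromℕ n)      ≈⟨ ℚᵘ.≃-sym (ℚ.toℚᵘ-homo-+ 1ℚ (fromℕ n)) ⟩
  ℚ.toℚᵘ (1ℚ + fromℕ n)                ∎)
  where
    open ℚᵘ.≃-Reasoning
    1+n≡ = trans (ℤP.*-identityʳ _) (cong (ℤ._+_ (+ 1)) (ℤP.*-identityʳ (+ n)))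

fromℕ-≤-/* : ∀ a b N D .{{_ : NonZero D}} → a ℕ.* D ℕ.≤ N ℕ.* b → fromℕ a ≤ ((+ N) ℚ./ D) * fromℕ b
fromℕ-≤-/* a b N (suc d) aD≤Nb = ℚ.toℚᵘ-cancel-≤ (begin
  ℚ.toℚᵘ (fromℕ a)                      ≃⟨ ℚ.toℚᵘ-fromℚᵘ (ℚᵘ.mkℚᵘ (+ a) 0) ⟩
  ℚᵘ.mkℚᵘ (+ a) 0                       ≤⟨ ℚᵘ.*≤* (subst₂ ℤ._≤_ lhs≡ rhs≡ (ℤ.+≤+ aD≤Nb′)) ⟩
  ℚᵘ.mkℚᵘ (+ N) d ℚᵘ.* ℚᵘ.mkℚᵘ (+ b) 0  ≃⟨ ℚᵘ.*-cong (ℚᵘ.≃-sym (ℚ.toℚᵘ-fromℚᵘ (ℚᵘ.mkℚᵘ (+ N) d)))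
                                                    (ℚᵘ.≃-sym (ℚ.toℚᵘ-fromℚᵘ (ℚᵘ.mkℚᵘ (+ b) 0))) ⟩
  ℚ.toℚᵘ t ℚᵘ.* ℚ.toℚᵘ (fromℕ b)        ≃⟨ ℚᵘ.≃-sym (ℚ.toℚᵘ-homo-* t (fromℕ b)) ⟩
  ℚ.toℚᵘ (t * fromℕ b)                  ∎)
  where
    open ℚᵘ.≤-Reasoning
    t = (+ N) ℚ./ suc d
    aD≤Nb′ : a ℕ.* (suc d ℕ.* 1) ℕ.≤ N ℕ.* b ℕ.* 1
    aD≤Nb′ = subst₂ ℕ._≤_ (cong (a ℕ.*_) (sym (ℕP.*-identityʳ (suc d)))) (sym (ℕP.*-identityʳ (N ℕ.* b)))
                     aD≤Nb
    lhs≡ = ℤP.pos-* a (suc d ℕ.* 1)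
    rhs≡ = trans (ℤP.pos-* (N ℕ.* b) 1) (cong (ℤ._* + 1) (ℤP.pos-* N b))

ratio-≤ : ∀ (p q w : ℚ) (a b N D : ℕ) .{{_ : NonZero D}} (pos : 0ℚ < q) →
  p ≡ w * fromℕ a → q ≡ w * fromℕ b → 0ℚ ≤ w → a ℕ.* D ℕ.≤ N ℕ.* b →
  p * (1/ q) {{ℚ.>-nonZero pos}} ≤ (+ N) ℚ./ D
ratio-≤ p q w a b N D pos p≡ q≡ 0≤w aD≤Nb = ℚ.*-cancelʳ-≤-pos q {{ℚ.positive pos}} (begin
  p * q⁻¹ * q       ≡⟨ ℚ.*-assoc p q⁻¹ q ⟩
  p * (q⁻¹ * q)     ≡⟨ cong (p *_) (ℚ.*-inverseˡ q {{ℚ.>-nonZero pos}}) ⟩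
  p * 1ℚ            ≡⟨ ℚ.*-identityʳ p ⟩
  p                 ≡⟨ p≡ ⟩
  w * fromℕ a       ≤⟨ ℚ.*-monoˡ-≤-nonNeg w {{ℚ.nonNegative 0≤w}} (fromℕ-≤-/* a b N D aD≤Nb) ⟩
  w * (t * fromℕ b) ≡⟨ ℚ.*-assoc w t (fromℕ b) ⟨
  w * t * fromℕ b   ≡⟨ cong (_* fromℕ b) (ℚ.*-comm w t) ⟩
  t * w * fromℕ b   ≡⟨ ℚ.*-assoc t w (fromℕ b) ⟩
  t * (w * fromℕ b) ≡⟨ cong (t *_) q≡ ⟨
  t * q             ∎)
  where
    open ℚ.≤-Reasoning
    q⁻¹ = (1/ q) {{ℚ.>-nonZero pos}}
    t = (+ N) ℚ./ D

sumList-indicator-constant : {X : Set} {A : Pred X _} (A? : Decidable A) (f : X → ℚ) (w : ℚ) →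
  (∀ s → A s → f s ≡ w) → ∀ ss → sumList (λ s → indicator (A? s) (f s)) ss ≡ w * fromℕ (count A? ss)
sumList-indicator-constant A? f w f≡w [] = sym (ℚ.*-zeroʳ w)
sumList-indicator-constant A? f w f≡w (s ∷ ss) with A? s
... | no _ = trans (ℚ.+-identityˡ _) (sumList-indicator-constant A? f w f≡w ss)
... | yes a = begin
  f s + sumList (λ s → indicator (A? s) (f s)) ss
    ≡⟨ cong₂ _+_ (f≡w s a) (sumList-indicator-constant A? f w f≡w ss) ⟩
  w + w * fromℕ (count A? ss)      ≡⟨ cong (_+ w * fromℕ (count A? ss)) (ℚ.*-identityʳ w) ⟨
  w * 1ℚ + w * fromℕ (count A? ss) ≡⟨ ℚ.*-distribˡ-+ w 1ℚ _ ⟨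
  w * (1ℚ + fromℕ (count A? ss))   ≡⟨ cong (w *_) (fromℕ-suc (count A? ss)) ⟨
  w * fromℕ (suc (count A? ss))    ∎
  where open ≡-Reasoning

sizesWeight : (m : ℕ) → (ℕ → ℚ) → {k : ℕ} → (Fin k → ℕ) → ℚ
sizesWeight m P {zero} x = 1ℚ
sizesWeight m P {suc k} x = P (x F.zero) * inv (m C x F.zero) * sizesWeight m P (x ∘ F.suc)

tupleWeight-SizesAre : ∀ m P {k} (x : Fin k → ℕ) (S : Vec (Subset m) k) → SizesAre x S →
  tupleWeight m P S ≡ sizesWeight m P x
tupleWeight-SizesAre m P x [] sizes = refl
tupleWeight-SizesAre m P x (S ∷ Ss) sizes =
  cong₂ _*_ (cong (λ j → P j * inv (m C j)) (sizes F.zero))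
            (tupleWeight-SizesAre m P (x ∘ F.suc) Ss (sizes ∘ F.suc))

sizesWeight-nonNeg : ∀ m P → IsProbOn m P → ∀ {k} (x : Fin k → ℕ) → 0ℚ ≤ sizesWeight m P x
sizesWeight-nonNeg m P isProb {zero} x = ℚ.nonNegative⁻¹ 1ℚ
sizesWeight-nonNeg m P isProb {suc k} x =
  *-nonNeg (*-nonNeg (proj₁ isProb (x F.zero)) (inv-nonNeg (m C x F.zero))) (sizesWeight-nonNeg m P isProb (x ∘ F.suc))
  where
    *-nonNeg : ∀ {p q} → 0ℚ ≤ p → 0ℚ ≤ q → 0ℚ ≤ p * q
    *-nonNeg {p} {q} 0≤p 0≤q =
      ℚ.nonNegative⁻¹ _ {{ℚ.nonNeg*nonNeg⇒nonNeg p {{ℚ.nonNegative 0≤p}} q {{ℚ.nonNegative 0≤q}}}}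
    inv-nonNeg : ∀ n → 0ℚ ≤ inv n
    inv-nonNeg zero = ℚ.≤-refl
    inv-nonNeg (suc n) = ℚ.nonNegative⁻¹ _ {{ℚ.normalize-nonNeg 1 (suc n)}}

Pr-SizesAre : ∀ k m P (x : Fin k → ℕ) {A : Pred (Vec (Subset m) k) _} (A? : Decidable A) →
  (∀ S → A S → SizesAre x S) → Pr k m P A? ≡ sizesWeight m P x * fromℕ (count A? (allTuples m k))
Pr-SizesAre k m P x A? A⇒sizes =
  sumList-indicator-constant A? (tupleWeight m P) (sizesWeight m P x)
    (λ S a → tupleWeight-SizesAre m P x S (A⇒sizes S a)) (allTuples m k)

lemma16 : (k m : ℕ) → .{{_ : NonZero m}} → (P : ℕ → ℚ) → IsProbOn m P →
          (x : Fin k → ℕ) →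
          (dR : Decidable (Rainbow {k} {m})) → (dB : Decidable (SizesAre {k} {m} x)) →
          (pos : 0ℚ < Pr k m P dB) →
          condPr k m P dR dB pos ≤ ℚ._/_ (+ (prodℕ x ^ (k ∸ 1))) (m ^ ((k ℕ.* (k ∸ 1)) ℕD./ 2)) {{m^n≢0 m ((k ℕ.* (k ∸ 1)) ℕD./ 2)}}
lemma16 k m P isProb x R? B? pos =
  ratio-≤ (Pr k m P (∩-dec R? B?)) (Pr k m P B?) (sizesWeight m P x)
    (count (∩-dec R? B?) (allTuples m k)) (count B? (allTuples m k))
    (prodℕ x ^ (k ∸ 1)) (m ^ ((k ℕ.* (k ∸ 1)) ℕD./ 2)) {{m^n≢0 m ((k ℕ.* (k ∸ 1)) ℕD./ 2)}} pos
    (Pr-SizesAre k m P x (∩-dec R? B?) (λ S → proj₂))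
    (Pr-SizesAre k m P x B? (λ S sizes → sizes))
    (sizesWeight-nonNeg m P isProb x)
    (rainbow-count-bound k m x R? B?)
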